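{- Let $G$ be a multigraph (multiple edges allowed, no loops) with maximum degree $\Delta(G)$ and maximum multiplicity $\mu(G)$, and let the palette be $\mathcal{K}=\{1,2,\dots,\Delta(G)+\mu(G)+1\}$. Let $M\subseteq E(G)$ be a distance-$3$ matching, and let each edge of $M$ be assigned an arbitrary colour from $\mathcal{K}$. Then this precolouring can be extended to a proper edge-colouring of all of $G$ using only colours from $\mathcal{K}$.
   Context: A proper edge-colouring assigns colours to edges so that any two edges sharing an end-vertex (including parallel edges) receive distinct colours. "Extending" a precolouring means producing a proper edge-colouring of all of $G$ that agrees with the given colours on the precoloured edges. The distance between two edges $e,f$ of $G$ is the number of vertices in a shortest path in $G$ between an end-vertex of $e$ and an end-vertex of $f$ (equivalently, their distance in the line graph); so edges sharing a vertex have distance $1$. A distance-$t$ matching is a set of edges with pairwise distance greater than $t$ (a matching is a distance-$1$ matching, an induced matching is a distance-$2$ matching). -}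

module Defs where

open import Data.Nat using (ℕ; _⊔_; _+_)
open import Data.Fin using (Fin)
open import Data.Fin.Properties using (_≟_)
open import Data.Fin.Subset using (Subset; _∈_)
open import Data.List using (List; length; filter; map; foldr)
open import Data.List using () renaming (allFin to allFinL)
open import Data.Product using (_×_; _,_; proj₁; proj₂; ∃-syntax)
open import Data.Sum using (_⊎_)
open import Relation.Binary.PropositionalEquality using (_≡_)
open import Relation.Nullary using (¬_)
open import Relation.Nullary.Decidable using (_⊎-dec_; _×-dec_)

-- A finite loopless multigraph: vertices Fin n, edges Fin m (edges are
-- distinguished objects, so parallel edges are allowed); each edge has two
-- distinct end-vertices.
record Multigraph : Set where
  field
    n      : ℕ
    m      : ℕ
    end₁   : Fin m → Fin n
    end₂   : Fin m → Fin n
    noLoop : (e : Fin m) → ¬ (end₁ e ≡ end₂ e)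

module _ (G : Multigraph) where
  open Multigraph G

  Incident : Fin m → Fin n → Set
  Incident e v = end₁ e ≡ v ⊎ end₂ e ≡ v

  Joins : Fin m → Fin n → Fin n → Set
  Joins e u v = (end₁ e ≡ u × end₂ e ≡ v) ⊎ (end₁ e ≡ v × end₂ e ≡ u)

  degree : Fin n → ℕ
  degree v = length (filter (λ e → (end₁ e ≟ v) ⊎-dec (end₂ e ≟ v)) (allFinL m))

  multiplicity : Fin n → Fin n → ℕ
  multiplicity u v = length (filter
    (λ e → ((end₁ e ≟ u) ×-dec (end₂ e ≟ v)) ⊎-dec ((end₁ e ≟ v) ×-dec (end₂ e ≟ u)))
    (allFinL m))

  maxℕ : List ℕ → ℕ
  maxℕ = foldr _⊔_ 0

  maxDegree : ℕ
  maxDegree = maxℕ (map degree (allFinL n))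

  maxMultiplicity : ℕ
  maxMultiplicity = maxℕ (map (λ u → maxℕ (map (multiplicity u) (allFinL n))) (allFinL n))

  Adjacent : Fin n → Fin n → Set
  Adjacent u v = ∃[ e ] Joins e u v

  Within3 : Fin n → Fin n → Set
  Within3 x y = x ≡ y ⊎ Adjacent x y ⊎ (∃[ z ] (Adjacent x z × Adjacent z y))

  EdgeDistAtMost3 : Fin m → Fin m → Set
  EdgeDistAtMost3 e f = ∃[ x ] ∃[ y ] (Incident e x × Incident f y × Within3 x y)

  Distance3Matching : Subset m → Set
  Distance3Matching M = ∀ e f → e ∈ M → f ∈ M → ¬ (e ≡ f) → ¬ EdgeDistAtMost3 e f

  ProperEdgeColouring : {C : Set} → (Fin m → C) → Set
  ProperEdgeColouring c = ∀ e f v → ¬ (e ≡ f) → Incident e v → Incident f v → ¬ (c e ≡ c f)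

  -- palette 𝒦 of size Δ(G) + μ(G) + 1 (colours 0 .. Δ+μ instead of 1 .. Δ+μ+1)
  Palette : Set
  Palette = Fin (maxDegree + maxMultiplicity + 1)

module Submission where

-- First colour G with Δ + μ colours (Vizing's theorem for multigraphs). An uncoloured edge e₀ at x starts a
-- fan of edges at x, each coloured with a colour missing at the far end (tip) of an earlier one. Every tip
-- misses at least μ colours while at most μ edges join x to a tip, so the fan can be grown until a tip shares
-- a missing colour with x (then shifting the fan colours e₀) or with an earlier tip (then an α/δ Kempe swap
-- reduces to the first case). Then keep this colour on the edges outside M, except that an edge whose colour equals the prescribed
-- colour of an adjacent edge of M gets the extra colour Δ + μ + 1. Two adjacent edges with the extra colour
-- would be next to edges of M at distance at most 3, hence to the same edge g of M, and would then share
-- g's colour in the Vizing colouring; a prescribed edge with the extra colour is handled in the same way.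

open import Defs
open import Level using (0ℓ)
open import Data.Nat using (ℕ; zero; suc; _+_; _*_; _≤_; _<_; _⊔_; z≤n; s≤s)
open import Data.Nat.Properties
  using (≤-trans; ≤-reflexive; ≤-pred; m≤n⇒m≤1+n; n≤1+n; +-suc; +-comm; +-identityʳ; +-mono-≤; +-monoʳ-≤;
         +-monoˡ-≤; +-monoʳ-<; +-cancelˡ-≤; 1+n≰n; n≮0; <-≤-trans; m≤m⊔n; m≤n⊔m; module ≤-Reasoning)
open import Data.Fin using (Fin; zero; suc; _↑ˡ_; _↑ʳ_; splitAt)
open import Data.Fin.Properties
  using (_≟_; all?; any?; suc-injective; 0≢1+n; ↑ˡ-injective; splitAt-↑ˡ; splitAt-↑ʳ)
open import Data.Fin.Subset using (Subset; _∉_; _∪_; ⁅_⁆) renaming (⊥ to ∅)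
open import Data.Fin.Subset.Properties using (_∈?_; ∉⊥; x∈⁅x⁆; x∈⁅y⁆⇒x≡y; x∈p∪q⁺; x∈p∪q⁻)
open import Data.Maybe using (Maybe; just; nothing)
import Data.Maybe as Maybe
open import Data.Maybe.Properties using (just-injective)
import Data.Maybe.Properties as Maybe
open import Data.Vec.Functional using (updateAt)
open import Data.Vec.Functional.Properties using (updateAt-updates; updateAt-minimal)
open import Data.List using (List; []; _∷_; length; filter; tabulate; map; foldr; allFin)
open import Data.List.Relation.Unary.Any using (Any; here; there)
import Data.List.Relation.Unary.Any as Any
open import Data.List.Membership.Propositional using (find; lose)
open import Data.List.Membership.Propositional.Properties using (∈-allFin; ∈-map⁺)
open import Data.Product using (Σ-syntax; _×_; _,_; proj₁; proj₂; ∃; ∃-syntax)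
open import Data.Sum using (_⊎_; inj₁; inj₂; [_,_]; [_,_]′)
open import Data.Empty using (⊥; ⊥-elim)
open import Function using (_∘_; const)
open import Relation.Nullary using (Dec; yes; no; ¬_)
open import Relation.Nullary.Decidable using (_⊎-dec_; _×-dec_; ¬?; _→-dec_; map′; toSum)
open import Relation.Unary using (Pred; Decidable; _⊆_)
open import Relation.Unary.Properties using (∁?; _∪?_)
open import Relation.Binary.PropositionalEquality using (_≡_; _≢_; refl; sym; trans; cong; subst)

private variable
  a b k : ℕ

count : {P : Pred (Fin k) 0ℓ} → Decidable P → ℕ
count {zero}  P? = 0
count {suc k} P? with P? zero
... | yes _ = suc (count (P? ∘ suc))
... | no  _ = count (P? ∘ suc)

count≤n : {P : Pred (Fin k) 0ℓ} (P? : Decidable P) → count P? ≤ k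
count≤n {zero}  P? = z≤n
count≤n {suc k} P? with P? zero
... | yes _ = s≤s (count≤n (P? ∘ suc))
... | no  _ = m≤n⇒m≤1+n (count≤n (P? ∘ suc))

count-none : {P : Pred (Fin k) 0ℓ} (P? : Decidable P) → (∀ i → ¬ P i) → count P? ≡ 0
count-none {zero}  P? none = refl
count-none {suc k} P? none with P? zero
... | yes p = ⊥-elim (none zero p)
... | no  _ = count-none (P? ∘ suc) (none ∘ suc)

0<count⇒∃ : {P : Pred (Fin k) 0ℓ} (P? : Decidable P) → 0 < count P? → ∃ P
0<count⇒∃ {suc k} P? pos with P? zero
... | yes p = zero , p
... | no  _ = let i , p = 0<count⇒∃ (P? ∘ suc) pos in suc i , p

count-mono : {P Q : Pred (Fin k) 0ℓ} (P? : Decidable P) (Q? : Decidable Q) → P ⊆ Q → count P? ≤ count Q?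
count-mono {zero}  P? Q? P⊆Q = z≤n
count-mono {suc k} P? Q? P⊆Q with P? zero | Q? zero
... | yes p | yes _ = s≤s (count-mono (P? ∘ suc) (Q? ∘ suc) P⊆Q)
... | yes p | no ¬q = ⊥-elim (¬q (P⊆Q p))
... | no  _ | yes _ = m≤n⇒m≤1+n (count-mono (P? ∘ suc) (Q? ∘ suc) P⊆Q)
... | no  _ | no  _ = count-mono (P? ∘ suc) (Q? ∘ suc) P⊆Q

count-strictMono : {P Q : Pred (Fin k) 0ℓ} (P? : Decidable P) (Q? : Decidable Q) → P ⊆ Q →
                   ∀ i → Q i → ¬ P i → count P? < count Q?
count-strictMono {suc k} P? Q? P⊆Q zero q ¬p with P? zero | Q? zero
... | yes p | _     = ⊥-elim (¬p p)
... | no  _ | no ¬q = ⊥-elim (¬q q)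
... | no  _ | yes _ = s≤s (count-mono (P? ∘ suc) (Q? ∘ suc) P⊆Q)
count-strictMono {suc k} P? Q? P⊆Q (suc i) q ¬p with P? zero | Q? zero
... | yes _ | yes _ = s≤s (count-strictMono (P? ∘ suc) (Q? ∘ suc) P⊆Q i q ¬p)
... | yes p | no ¬q = ⊥-elim (¬q (P⊆Q p))
... | no  _ | yes _ = m≤n⇒m≤1+n (count-strictMono (P? ∘ suc) (Q? ∘ suc) P⊆Q i q ¬p)
... | no  _ | no  _ = count-strictMono (P? ∘ suc) (Q? ∘ suc) P⊆Q i q ¬p

count+count∁≡n : {P : Pred (Fin k) 0ℓ} (P? : Decidable P) → count P? + count (∁? P?) ≡ k
count+count∁≡n {zero}  P? = refl
count+count∁≡n {suc k} P? with P? zero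
... | yes _ = cong suc (count+count∁≡n (P? ∘ suc))
... | no  _ = trans (+-suc _ _) (cong suc (count+count∁≡n (P? ∘ suc)))

count-∪ : {P Q : Pred (Fin k) 0ℓ} (P? : Decidable P) (Q? : Decidable Q) →
          count (P? ∪? Q?) ≤ count P? + count Q?
count-∪ {zero}  P? Q? = z≤n
count-∪ {suc k} P? Q? with P? zero | Q? zero
... | yes _ | yes _ = s≤s (≤-trans (count-∪ (P? ∘ suc) (Q? ∘ suc))
                                   (+-monoʳ-≤ (count (P? ∘ suc)) (n≤1+n _)))
... | yes _ | no  _ = s≤s (count-∪ (P? ∘ suc) (Q? ∘ suc))
... | no  _ | yes _ = subst (suc (count ((P? ∪? Q?) ∘ suc)) ≤_) (sym (+-suc _ _))
                              (s≤s (count-∪ (P? ∘ suc) (Q? ∘ suc)))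
... | no  _ | no  _ = count-∪ (P? ∘ suc) (Q? ∘ suc)

count-∪-disjoint : {P Q : Pred (Fin k) 0ℓ} (P? : Decidable P) (Q? : Decidable Q) →
                   (∀ {i} → P i → Q i → ⊥) → count P? + count Q? ≤ count (P? ∪? Q?)
count-∪-disjoint {zero}  P? Q? disj = z≤n
count-∪-disjoint {suc k} P? Q? disj with P? zero | Q? zero
... | yes p | yes q = ⊥-elim (disj p q)
... | yes _ | no  _ = s≤s (count-∪-disjoint (P? ∘ suc) (Q? ∘ suc) disj)
... | no  _ | yes _ = subst (_≤ suc (count ((P? ∪? Q?) ∘ suc))) (sym (+-suc _ _))
                              (s≤s (count-∪-disjoint (P? ∘ suc) (Q? ∘ suc) disj))
... | no  _ | no  _ = count-∪-disjoint (P? ∘ suc) (Q? ∘ suc) disj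

count-injection : {P : Pred (Fin a) 0ℓ} {Q : Pred (Fin b) 0ℓ} (P? : Decidable P) (Q? : Decidable Q)
                  (f : ∀ {i} → P i → Fin b) → (∀ {i} (p : P i) → Q (f p)) →
                  (∀ {i j} (p : P i) (p′ : P j) → f p ≡ f p′ → i ≡ j) →
                  count P? ≤ count Q?
count-injection {zero} P? Q? f f∈Q f-inj = z≤n
count-injection {suc a} {b} {P} {Q} P? Q? f f∈Q f-inj with P? zero
... | no  _ = count-injection (P? ∘ suc) Q? f f∈Q (λ p p′ eq → suc-injective (f-inj p p′ eq))
... | yes p₀ = ≤-trans (s≤s (count-injection (P? ∘ suc) Q∖j₀? f f∈Q∖j₀ f-inj′))
                       (count-strictMono Q∖j₀? Q? proj₁ (f p₀) (f∈Q p₀) (λ (_ , ne) → ne refl))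
  where
  Q∖j₀ : Pred (Fin b) 0ℓ
  Q∖j₀ j = Q j × j ≢ f p₀
  Q∖j₀? : Decidable Q∖j₀
  Q∖j₀? j = Q? j ×-dec ¬? (j ≟ f p₀)
  f∈Q∖j₀ : ∀ {i} (p : P (suc i)) → Q∖j₀ (f p)
  f∈Q∖j₀ p = f∈Q p , λ eq → 0≢1+n (sym (f-inj p p₀ eq))
  f-inj′ : ∀ {i j} (p : P (suc i)) (p′ : P (suc j)) → f p ≡ f p′ → i ≡ j
  f-inj′ p p′ eq = suc-injective (f-inj p p′ eq)

length-filter-tabulate : {A : Set} {R : Pred A 0ℓ} (R? : Decidable R) (g : Fin k → A) →
                         length (filter R? (tabulate g)) ≡ count (R? ∘ g)
length-filter-tabulate {zero}  R? g = refl
length-filter-tabulate {suc k} R? g with R? (g zero)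
... | yes _ = cong suc (length-filter-tabulate R? (g ∘ suc))
... | no  _ = length-filter-tabulate R? (g ∘ suc)

module _ (G : Multigraph) where
  open Multigraph G

  incident? : ∀ e v → Dec (Incident G e v)
  incident? e v = (end₁ e ≟ v) ⊎-dec (end₂ e ≟ v)

  -- The end of e opposite to v; a junk value (end₁ e) when v is not an end of e.
  other : Fin m → Fin n → Fin n
  other e v with end₁ e ≟ v
  ... | yes _ = end₂ e
  ... | no  _ = end₁ e

  incident-other : ∀ e v → Incident G e (other e v)
  incident-other e v with end₁ e ≟ v
  ... | yes _ = inj₂ refl
  ... | no  _ = inj₁ refl

  other≢ : ∀ {e v} → Incident G e v → other e v ≢ v
  other≢ {e} {v} _ with end₁ e ≟ v
  ... | yes e₁≡v = λ e₂≡v → noLoop e (trans e₁≡v (sym e₂≡v))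
  ... | no  e₁≢v = e₁≢v

  incident-ends : ∀ {e v u} → Incident G e v → Incident G e u → u ≡ v ⊎ u ≡ other e v
  incident-ends {e} {v} _ u-inc with end₁ e ≟ v
  incident-ends _          (inj₁ e₁≡u) | yes e₁≡v = inj₁ (trans (sym e₁≡u) e₁≡v)
  incident-ends _          (inj₂ e₂≡u) | yes _    = inj₂ (sym e₂≡u)
  incident-ends (inj₁ e₁≡v) _          | no e₁≢v = ⊥-elim (e₁≢v e₁≡v)
  incident-ends (inj₂ _)    (inj₁ e₁≡u) | no _    = inj₂ (sym e₁≡u)
  incident-ends (inj₂ e₂≡v) (inj₂ e₂≡u) | no _    = inj₁ (trans (sym e₂≡u) e₂≡v)

  joins-other : ∀ {e v} → Incident G e v → Joins G e v (other e v)
  joins-other {e} {v} _ with end₁ e ≟ v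
  joins-other _           | yes e₁≡v = inj₁ (e₁≡v , refl)
  joins-other (inj₁ e₁≡v) | no e₁≢v  = ⊥-elim (e₁≢v e₁≡v)
  joins-other (inj₂ e₂≡v) | no _     = inj₂ (refl , e₂≡v)

  degree≡count : ∀ v → degree G v ≡ count (λ e → incident? e v)
  degree≡count v = length-filter-tabulate (λ e → incident? e v) (λ e → e)

  joins? : ∀ e u v → Dec (Joins G e u v)
  joins? e u v = ((end₁ e ≟ u) ×-dec (end₂ e ≟ v)) ⊎-dec ((end₁ e ≟ v) ×-dec (end₂ e ≟ u))

  multiplicity≡count : ∀ u v → multiplicity G u v ≡ count (λ e → joins? e u v)
  multiplicity≡count u v = length-filter-tabulate (λ e → joins? e u v) (λ e → e)

  module PartialColouring (k : ℕ) where

    Colouring : Set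
    Colouring = Fin m → Maybe (Fin k)

    Coloured : Colouring → Fin m → Set
    Coloured φ f = ∃[ c ] φ f ≡ just c

    coloured? : ∀ φ f → Dec (Coloured φ f)
    coloured? φ f with φ f
    ... | just c  = yes (c , refl)
    ... | nothing = no λ ()

    uncoloured⇒¬coloured : ∀ {φ f} → φ f ≡ nothing → ¬ Coloured φ f
    uncoloured⇒¬coloured φf (c , φf′) with () ← trans (sym φf) φf′

    ¬coloured⇒uncoloured : ∀ {φ f} → ¬ Coloured φ f → φ f ≡ nothing
    ¬coloured⇒uncoloured {φ} {f} ¬coloured with φ f
    ... | nothing = refl
    ... | just c  = ⊥-elim (¬coloured (c , refl))

    Proper : Colouring → Set
    Proper φ = ∀ {e f v c} → e ≢ f → Incident G e v → Incident G f v →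
               φ e ≡ just c → φ f ≡ just c → ⊥

    proper-unique : ∀ {φ} → Proper φ → ∀ {f f′ v c} → Incident G f v → Incident G f′ v →
                    φ f ≡ just c → φ f′ ≡ just c → f ≡ f′
    proper-unique proper {f} {f′} f-inc f′-inc φf φf′ with f ≟ f′
    ... | yes f≡f′ = f≡f′
    ... | no  f≢f′ = ⊥-elim (proper f≢f′ f-inc f′-inc φf φf′)

    Missing : Colouring → Fin n → Fin k → Set
    Missing φ v c = ∀ {f} → Incident G f v → φ f ≢ just c

    missing? : ∀ φ v c → Dec (Missing φ v c)
    missing? φ v c = map′ (λ h {f} → h f) (λ h f → h {f})
      (all? λ f → incident? f v →-dec ¬? (Maybe.≡-dec _≟_ (φ f) (just c)))

    present-edge : ∀ {φ v c} → ¬ Missing φ v c → ∃[ f ] Incident G f v × φ f ≡ just c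
    present-edge {φ} {v} {c} ¬missing
      with any? (λ f → incident? f v ×-dec Maybe.≡-dec _≟_ (φ f) (just c))
    ... | yes found = found
    ... | no  none  = ⊥-elim (¬missing λ {f} f-inc φf → none (f , f-inc , φf))

    _[_≔_] : Colouring → Fin m → Maybe (Fin k) → Colouring
    φ [ g ≔ o ] = updateAt φ g (const o)

    assign-eq : ∀ φ g o → (φ [ g ≔ o ]) g ≡ o
    assign-eq φ g o = updateAt-updates g φ

    assign-neq : ∀ φ {g} o {f} → f ≢ g → (φ [ g ≔ o ]) f ≡ φ f
    assign-neq φ {g} o {f} f≢g = updateAt-minimal f g φ f≢g

    assign-coloured : ∀ φ g c {f} → Coloured φ f → Coloured (φ [ g ≔ just c ]) f
    assign-coloured φ g c {f} (c′ , φf) with f ≟ g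
    ... | yes refl = c , assign-eq φ g (just c)
    ... | no  f≢g  = c′ , trans (assign-neq φ (just c) f≢g) φf

    assign-missing : ∀ φ {g} o {v c} → ¬ Incident G g v → Missing φ v c → Missing (φ [ g ≔ o ]) v c
    assign-missing φ {g} o ¬g-inc missing {f} f-inc φ′f with f ≟ g
    ... | yes refl = ¬g-inc f-inc
    ... | no  f≢g  = missing f-inc (trans (sym (assign-neq φ o f≢g)) φ′f)

    total⇒proper : ∀ {φ} → Proper φ → (∀ f → Coloured φ f) → ∃[ c ] ProperEdgeColouring G {Fin k} c
    total⇒proper {φ} proper coloured = colour , colour-proper
      where
      colour : Fin m → Fin k
      colour f = proj₁ (coloured f)
      colour-proper : ProperEdgeColouring G colour
      colour-proper e f v e≢f e-inc f-inc same =
        proper e≢f e-inc f-inc (proj₂ (coloured e)) (trans (proj₂ (coloured f)) (cong just (sym same)))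

    assign-proper : ∀ {φ g α} → Proper φ → (∀ {u} → Incident G g u → Missing φ u α) →
                    Proper (φ [ g ≔ just α ])
    assign-proper {φ} {g} {α} proper α-free {e} {f} e≢f e-inc f-inc φ′e φ′f
      with e ≟ g | f ≟ g
    ... | yes refl | yes refl = e≢f refl
    ... | yes refl | no f≢g =
      α-free e-inc f-inc (trans (sym (assign-neq φ _ f≢g)) (trans φ′f (trans (sym φ′e) (assign-eq φ g _))))
    ... | no e≢g | yes refl =
      α-free f-inc e-inc (trans (sym (assign-neq φ _ e≢g)) (trans φ′e (trans (sym φ′f) (assign-eq φ g _))))
    ... | no e≢g | no f≢g =
      proper e≢f e-inc f-inc (trans (sym (assign-neq φ _ e≢g)) φ′e) (trans (sym (assign-neq φ _ f≢g)) φ′f)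

module KempeChains where

  open import Data.Fin.Subset using (_∈_)

  x∈p∪⁅x⁆ : ∀ {n} (p : Subset n) x → x ∈ p ∪ ⁅ x ⁆
  x∈p∪⁅x⁆ p x = x∈p∪q⁺ (inj₂ (x∈⁅x⁆ x))

  x∈p⇒x∈p∪⁅y⁆ : ∀ {n} {p : Subset n} {x} y → x ∈ p → x ∈ p ∪ ⁅ y ⁆
  x∈p⇒x∈p∪⁅y⁆ y x∈p = x∈p∪q⁺ (inj₁ x∈p)

  x∈p∪⁅y⁆⁻ : ∀ {n} (p : Subset n) y {x} → x ∈ p ∪ ⁅ y ⁆ → x ∈ p ⊎ x ≡ y
  x∈p∪⁅y⁆⁻ p y x∈p∪⁅y⁆ with x∈p∪q⁻ p ⁅ y ⁆ x∈p∪⁅y⁆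
  ... | inj₁ x∈p   = inj₁ x∈p
  ... | inj₂ x∈⁅y⁆ = inj₂ (x∈⁅y⁆⇒x≡y y x∈⁅y⁆)

  module _ (G : Multigraph) (k : ℕ) where
    open Multigraph G
    open PartialColouring G k

    module Kempe {φ : Colouring} (proper : Proper φ) {α δ : Fin k} (α≢δ : α ≢ δ) where

      swap : Fin k → Fin k
      swap c with c ≟ α | c ≟ δ
      ... | yes _ | _     = δ
      ... | no  _ | yes _ = α
      ... | no  _ | no  _ = c

      swap-α : swap α ≡ δ
      swap-α with α ≟ α
      ... | yes _  = refl
      ... | no α≢α = ⊥-elim (α≢α refl)

      swap-δ : swap δ ≡ α
      swap-δ with δ ≟ α | δ ≟ δ
      ... | yes δ≡α | _      = ⊥-elim (α≢δ (sym δ≡α))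
      ... | no  _   | yes _  = refl
      ... | no  _   | no δ≢δ = ⊥-elim (δ≢δ refl)

      swap-other : ∀ {c} → c ≢ α → c ≢ δ → swap c ≡ c
      swap-other {c} c≢α c≢δ with c ≟ α | c ≟ δ
      ... | yes c≡α | _       = ⊥-elim (c≢α c≡α)
      ... | no  _   | yes c≡δ = ⊥-elim (c≢δ c≡δ)
      ... | no  _   | no  _   = refl

      swap-involutive : ∀ c → swap (swap c) ≡ c
      swap-involutive c with c ≟ α | c ≟ δ
      ... | yes refl | _        = swap-δ
      ... | no  _    | yes refl = swap-α
      ... | no  c≢α  | no  c≢δ  = swap-other c≢α c≢δ

      αδ-or-fixed : ∀ c → (c ≡ α ⊎ c ≡ δ) ⊎ swap c ≡ c
      αδ-or-fixed c with c ≟ α | c ≟ δ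
      ... | yes c≡α | _       = inj₁ (inj₁ c≡α)
      ... | no  _   | yes c≡δ = inj₁ (inj₂ c≡δ)
      ... | no  _   | no  _   = inj₂ refl

      αδ-swap⁻ : ∀ {c} → swap c ≡ α ⊎ swap c ≡ δ → c ≡ α ⊎ c ≡ δ
      αδ-swap⁻ {c} (inj₁ sc≡α) = inj₂ (trans (sym (swap-involutive c)) (trans (cong swap sc≡α) swap-α))
      αδ-swap⁻ {c} (inj₂ sc≡δ) = inj₁ (trans (sym (swap-involutive c)) (trans (cong swap sc≡δ) swap-δ))

      map-swap⁻ : ∀ o {c} → Maybe.map swap o ≡ just c → o ≡ just (swap c)
      map-swap⁻ (just c′) eq = cong just (trans (sym (swap-involutive c′)) (cong swap (just-injective eq)))

      Bicoloured : Fin m → Set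
      Bicoloured f = φ f ≡ just α ⊎ φ f ≡ just δ

      bicoloured? : ∀ f → Dec (Bicoloured f)
      bicoloured? f = Maybe.≡-dec _≟_ (φ f) (just α) ⊎-dec Maybe.≡-dec _≟_ (φ f) (just δ)

      bicoloured : ∀ {f c} → φ f ≡ just c → c ≡ α ⊎ c ≡ δ → Bicoloured f
      bicoloured φf (inj₁ refl) = inj₁ φf
      bicoloured φf (inj₂ refl) = inj₂ φf

      Touches : Subset m → Fin n → Set
      Touches S u = ∃[ f ] Incident G f u × f ∈ S

      touches? : ∀ S u → Dec (Touches S u)
      touches? S u = any? λ f → incident? G f u ×-dec f ∈? S

      BalancedAt : Subset m → Fin n → Set
      BalancedAt S u = ∀ {f f′} → Incident G f u → Incident G f′ u → Bicoloured f′ → f ∈ S → f′ ∈ S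

      -- A union of components of the subgraph formed by the edges coloured α or δ.
      record Closed (S : Subset m) : Set where
        field
          bicoloured-⊆ : ∀ {f} → f ∈ S → Bicoloured f
          balanced     : ∀ {u} → BalancedAt S u

      swapOn : Subset m → Colouring
      swapOn S f with f ∈? S
      ... | yes _ = Maybe.map swap (φ f)
      ... | no  _ = φ f

      module _ {S : Subset m} (closed : Closed S) where
        open Closed closed

        swapOn-∈ : ∀ {f c} → f ∈ S → φ f ≡ just c → swapOn S f ≡ just (swap c)
        swapOn-∈ {f} f∈S φf with f ∈? S
        ... | yes _   = cong (Maybe.map swap) φf
        ... | no  f∉S = ⊥-elim (f∉S f∈S)

        swapOn-∈⁻ : ∀ {f c} → f ∈ S → swapOn S f ≡ just c → φ f ≡ just (swap c)
        swapOn-∈⁻ {f} f∈S φ′f with f ∈? S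
        ... | yes _   = map-swap⁻ (φ f) φ′f
        ... | no  f∉S = ⊥-elim (f∉S f∈S)

        swapOn-∉ : ∀ {f} → f ∉ S → swapOn S f ≡ φ f
        swapOn-∉ {f} f∉S with f ∈? S
        ... | yes f∈S = ⊥-elim (f∉S f∈S)
        ... | no  _   = refl

        swapOn-αδ : ∀ {f c} → f ∈ S → swapOn S f ≡ just c → c ≡ α ⊎ c ≡ δ
        swapOn-αδ f∈S φ′f with bicoloured-⊆ f∈S
        ... | inj₁ φf = αδ-swap⁻ (inj₁ (just-injective (trans (sym (swapOn-∈⁻ f∈S φ′f)) φf)))
        ... | inj₂ φf = αδ-swap⁻ (inj₂ (just-injective (trans (sym (swapOn-∈⁻ f∈S φ′f)) φf)))

        swapOn-proper : Proper (swapOn S)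
        swapOn-proper {e} {f} e≢f e-inc f-inc φ′e φ′f = by-membership (e ∈? S) (f ∈? S)
          where
          by-membership : Dec (e ∈ S) → Dec (f ∈ S) → ⊥
          by-membership (yes e∈S) (yes f∈S) =
            proper e≢f e-inc f-inc (swapOn-∈⁻ e∈S φ′e) (swapOn-∈⁻ f∈S φ′f)
          by-membership (no e∉S) (no f∉S) =
            proper e≢f e-inc f-inc (trans (sym (swapOn-∉ e∉S)) φ′e) (trans (sym (swapOn-∉ f∉S)) φ′f)
          by-membership (yes e∈S) (no f∉S) =
            f∉S (balanced e-inc f-inc (bicoloured (trans (sym (swapOn-∉ f∉S)) φ′f) (swapOn-αδ e∈S φ′e)) e∈S)
          by-membership (no e∉S) (yes f∈S) =
            e∉S (balanced f-inc e-inc (bicoloured (trans (sym (swapOn-∉ e∉S)) φ′e) (swapOn-αδ f∈S φ′f)) f∈S)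

        swapOn-missing : ∀ {u c} → Touches S u → Missing φ u (swap c) → Missing (swapOn S) u c
        swapOn-missing {u} {c} (g , g-inc , g∈S) missing {f} f-inc φ′f = by-membership (f ∈? S)
          where
          by-membership : Dec (f ∈ S) → ⊥
          by-membership (yes f∈S) = missing f-inc (swapOn-∈⁻ f∈S φ′f)
          by-membership (no f∉S) with φf ← trans (sym (swapOn-∉ f∉S)) φ′f | αδ-or-fixed c
          ... | inj₁ c∈αδ = f∉S (balanced g-inc f-inc (bicoloured φf c∈αδ) g∈S)
          ... | inj₂ sc≡c = missing f-inc (trans φf (cong just (sym sc≡c)))

        untouched-∉ : ∀ {u f} → ¬ Touches S u → Incident G f u → f ∉ S
        untouched-∉ ¬touches f-inc f∈S = ¬touches (_ , f-inc , f∈S)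

        swapOn-missing-untouched : ∀ {u c} → ¬ Touches S u → Missing φ u c → Missing (swapOn S) u c
        swapOn-missing-untouched ¬touches missing f-inc φ′f =
          missing f-inc (trans (sym (swapOn-∉ (untouched-∉ ¬touches f-inc))) φ′f)

        swapOn-missing-other : ∀ {u c} → c ≢ α → c ≢ δ → Missing φ u c → Missing (swapOn S) u c
        swapOn-missing-other {u} c≢α c≢δ missing with touches? S u
        ... | yes touches = swapOn-missing touches (subst (Missing φ u) (sym (swap-other c≢α c≢δ)) missing)
        ... | no ¬touches = swapOn-missing-untouched ¬touches missing

        swapOn-coloured : ∀ {f} → Coloured φ f → Coloured (swapOn S) f
        swapOn-coloured {f} (c , φf) with f ∈? S
        ... | yes _ = swap c , cong (Maybe.map swap) φf
        ... | no  _ = c , φf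

        swapOn-uncoloured : ∀ {f} → φ f ≡ nothing → swapOn S f ≡ nothing
        swapOn-uncoloured {f} φf with f ∈? S
        ... | yes _ = cong (Maybe.map swap) φf
        ... | no  _ = φf

      Saturated : Fin n → Set
      Saturated u = ¬ Missing φ u α × ¬ Missing φ u δ

      Complementary : Fin k → Fin k → Set
      Complementary c c′ = (c ≡ α × c′ ≡ δ) ⊎ (c ≡ δ × c′ ≡ α)

      complementary-sym : ∀ {c c′} → Complementary c c′ → Complementary c′ c
      complementary-sym (inj₁ (c≡α , c′≡δ)) = inj₂ (c′≡δ , c≡α)
      complementary-sym (inj₂ (c≡δ , c′≡α)) = inj₁ (c′≡α , c≡δ)

      complementary-≢ : ∀ {c c′} → Complementary c c′ → c ≢ c′
      complementary-≢ (inj₁ (refl , refl)) = α≢δ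
      complementary-≢ (inj₂ (refl , refl)) = α≢δ ∘ sym

      complementary-bicoloured : ∀ {c c′ f} → Complementary c c′ → φ f ≡ just c → Bicoloured f
      complementary-bicoloured (inj₁ (refl , refl)) = inj₁
      complementary-bicoloured (inj₂ (refl , refl)) = inj₂

      complementary-bicoloured⁻ : ∀ {c c′ f} → Complementary c c′ → Bicoloured f →
                                  φ f ≡ just c ⊎ φ f ≡ just c′
      complementary-bicoloured⁻ (inj₁ (refl , refl)) bic          = bic
      complementary-bicoloured⁻ (inj₂ (refl , refl)) (inj₁ φf≡α) = inj₂ φf≡α
      complementary-bicoloured⁻ (inj₂ (refl , refl)) (inj₂ φf≡δ) = inj₁ φf≡δ

      complementary-saturated : ∀ {c c′ u} → Complementary c c′ →
                                ¬ Missing φ u c → ¬ Missing φ u c′ → Saturated u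
      complementary-saturated (inj₁ (refl , refl)) c-present c′-present = c-present , c′-present
      complementary-saturated (inj₂ (refl , refl)) c-present c′-present = c′-present , c-present

      -- Follows the path of alternating α and δ edges starting at a; it stops where the next colour is missing.
      module Chain (a : Fin n) (δ-missing : Missing φ a δ) (α-present : ¬ Missing φ a α) where

        record KempeChain : Set where
          field
            edges         : Subset m
            closed        : Closed edges
            touches-start : Touches edges a
            end           : Fin n
            touched       : ∀ {u} → Touches edges u → u ≡ a ⊎ u ≡ end ⊎ Saturated u

        -- An initial segment S of the path, from a to v, whose next edge would be coloured c.
        record Trail (S : Subset m) (v : Fin n) (c c′ : Fin k) : Set where
          field
            complementary   : Complementary c c′
            bicoloured-⊆    : ∀ {f} → f ∈ S → Bicoloured f
            balanced-inner  : ∀ {u} → u ≢ v → BalancedAt S u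
            entered         : ∀ {f} → Incident G f v → φ f ≡ just c′ → f ∈ S
            unexplored      : ∀ {f} → Incident G f v → φ f ≡ just c → f ∉ S
            inner-saturated : ∀ {u} → u ≢ a → u ≢ v → Touches S u → Saturated u
            end-touched     : v ≡ a ⊎ Touches S v
            start-touched   : Touches S a ⊎ (v ≡ a × c ≡ α)

        trail-start : Trail ∅ a α δ
        trail-start = record
          { complementary   = inj₁ (refl , refl)
          ; bicoloured-⊆    = λ f∈∅ → ⊥-elim (∉⊥ f∈∅)
          ; balanced-inner  = λ _ _ _ _ f∈∅ → ⊥-elim (∉⊥ f∈∅)
          ; entered         = λ f-inc φf → ⊥-elim (δ-missing f-inc φf)
          ; unexplored      = λ _ _ → ∉⊥
          ; inner-saturated = λ _ _ (_ , _ , f∈∅) → ⊥-elim (∉⊥ f∈∅)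
          ; end-touched     = inj₁ refl
          ; start-touched   = inj₂ (refl , refl)
          }

        unvisited : Subset m → ℕ
        unvisited S = count (λ f → bicoloured? f ×-dec ¬? (f ∈? S))

        module _ {S v c c′} (trail : Trail S v c c′) where
          open Trail trail

          trail-extend : ∀ {e} → Incident G e v → φ e ≡ just c → Trail (S ∪ ⁅ e ⁆) (other G e v) c′ c
          trail-extend {e} e-inc φe = record
            { complementary   = complementary-sym complementary
            ; bicoloured-⊆    = bicoloured-⊆′
            ; balanced-inner  = balanced-inner′
            ; entered         = λ f-inc φf →
                subst (_∈ S′) (sym (proper-unique proper f-inc (incident-other G e v) φf φe)) (x∈p∪⁅x⁆ S e)
            ; unexplored      = unexplored′
            ; inner-saturated = inner-saturated′
            ; end-touched     = inj₂ (e , incident-other G e v , x∈p∪⁅x⁆ S e)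
            ; start-touched   = inj₁ start-touched′
            }
            where
            S′ : Subset m
            S′ = S ∪ ⁅ e ⁆
            v′ : Fin n
            v′ = other G e v

            e-bicoloured : Bicoloured e
            e-bicoloured = complementary-bicoloured complementary φe

            e-away : ∀ {u} → u ≢ v → u ≢ v′ → ¬ Incident G e u
            e-away u≢v u≢v′ e-inc-u with incident-ends G e-inc e-inc-u
            ... | inj₁ u≡v  = u≢v u≡v
            ... | inj₂ u≡v′ = u≢v′ u≡v′

            bicoloured-⊆′ : ∀ {f} → f ∈ S′ → Bicoloured f
            bicoloured-⊆′ f∈S′ with x∈p∪⁅y⁆⁻ S e f∈S′
            ... | inj₁ f∈S = bicoloured-⊆ f∈S
            ... | inj₂ refl = e-bicoloured

            balanced-inner′ : ∀ {u} → u ≢ v′ → BalancedAt S′ u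
            balanced-inner′ {u} u≢v′ {f} {f′} f-inc f′-inc f′-bic f∈S′ with u ≟ v
            ... | yes refl with complementary-bicoloured⁻ complementary f′-bic
            ...   | inj₁ φf′ = subst (_∈ S′) (sym (proper-unique proper f′-inc e-inc φf′ φe)) (x∈p∪⁅x⁆ S e)
            ...   | inj₂ φf′ = x∈p⇒x∈p∪⁅y⁆ e (entered f′-inc φf′)
            balanced-inner′ {u} u≢v′ {f} {f′} f-inc f′-inc f′-bic f∈S′ | no u≢v
              with x∈p∪⁅y⁆⁻ S e f∈S′
            ... | inj₂ refl = ⊥-elim (e-away u≢v u≢v′ f-inc)
            ... | inj₁ f∈S  = x∈p⇒x∈p∪⁅y⁆ e (balanced-inner u≢v f-inc f′-inc f′-bic f∈S)

            unexplored′ : ∀ {f} → Incident G f v′ → φ f ≡ just c′ → f ∉ S′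
            unexplored′ {f} f-inc φf f∈S′ with x∈p∪⁅y⁆⁻ S e f∈S′
            ... | inj₂ refl = complementary-≢ complementary (just-injective (trans (sym φe) φf))
            ... | inj₁ f∈S  = unexplored e-inc φe
                (balanced-inner (other≢ G e-inc) f-inc (incident-other G e v) e-bicoloured f∈S)

            inner-saturated′ : ∀ {u} → u ≢ a → u ≢ v′ → Touches S′ u → Saturated u
            inner-saturated′ {u} u≢a u≢v′ (g , g-inc , g∈S′) with u ≟ v
            ... | yes refl = complementary-saturated complementary (λ missing → missing e-inc φe) c′-present
              where
              c′-present : ¬ Missing φ u c′
              c′-present missing with end-touched
              ... | inj₁ v≡a = u≢a v≡a
              ... | inj₂ (h , h-inc , h∈S) with complementary-bicoloured⁻ complementary (bicoloured-⊆ h∈S)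
              ...   | inj₁ φh = unexplored h-inc φh h∈S
              ...   | inj₂ φh = missing h-inc φh
            ... | no u≢v with x∈p∪⁅y⁆⁻ S e g∈S′
            ...   | inj₂ refl = ⊥-elim (e-away u≢v u≢v′ g-inc)
            ...   | inj₁ g∈S  = inner-saturated u≢a u≢v (g , g-inc , g∈S)

            start-touched′ : Touches S′ a
            start-touched′ with start-touched
            ... | inj₁ (g , g-inc , g∈S) = g , g-inc , x∈p⇒x∈p∪⁅y⁆ e g∈S
            ... | inj₂ (refl , _)        = e , e-inc , x∈p∪⁅x⁆ S e

          trail-finish : Missing φ v c → KempeChain
          trail-finish c-missing = record
            { edges = S
            ; closed = record { bicoloured-⊆ = bicoloured-⊆ ; balanced = balanced }
            ; touches-start = touches-start
            ; end = v
            ; touched = touched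
            }
            where
            balanced : ∀ {u} → BalancedAt S u
            balanced {u} f-inc f′-inc f′-bic f∈S with u ≟ v
            ... | no u≢v = balanced-inner u≢v f-inc f′-inc f′-bic f∈S
            ... | yes refl with complementary-bicoloured⁻ complementary f′-bic
            ...   | inj₁ φf′ = ⊥-elim (c-missing f′-inc φf′)
            ...   | inj₂ φf′ = entered f′-inc φf′

            touches-start : Touches S a
            touches-start with start-touched
            ... | inj₁ touches         = touches
            ... | inj₂ (refl , refl) = ⊥-elim (α-present c-missing)

            touched : ∀ {u} → Touches S u → u ≡ a ⊎ u ≡ v ⊎ Saturated u
            touched {u} touches with u ≟ a | u ≟ v
            ... | yes u≡a | _       = inj₁ u≡a
            ... | no  _   | yes u≡v = inj₂ (inj₁ u≡v)
            ... | no  u≢a | no  u≢v = inj₂ (inj₂ (inner-saturated u≢a u≢v touches))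

          unvisited-shrinks : ∀ {e} → Incident G e v → φ e ≡ just c → unvisited (S ∪ ⁅ e ⁆) < unvisited S
          unvisited-shrinks {e} e-inc φe =
            count-strictMono _ _ (λ (bic , f∉S′) → bic , f∉S′ ∘ x∈p⇒x∈p∪⁅y⁆ e) e
              (complementary-bicoloured complementary φe , unexplored e-inc φe)
              (λ (_ , e∉S′) → e∉S′ (x∈p∪⁅x⁆ S e))

        follow : ∀ bound {S v c c′} → Trail S v c c′ → unvisited S ≤ bound → KempeChain
        follow bound {S} {v} {c} trail ≤bound with missing? φ v c
        ... | yes c-missing = trail-finish trail c-missing
        ... | no c-present with e , e-inc , φe ← present-edge c-present | bound
        ...   | zero = ⊥-elim (n≮0 (<-≤-trans (unvisited-shrinks trail e-inc φe) ≤bound))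
        ...   | suc bound′ =
          follow bound′ (trail-extend trail e-inc φe) (≤-pred (<-≤-trans (unvisited-shrinks trail e-inc φe) ≤bound))

        kempeChain : KempeChain
        kempeChain = follow m trail-start (count≤n _)

module VizingFans where

  open import Data.List.Membership.Propositional using (_∈_)
  open KempeChains
  import Data.Fin.Subset as Subset

  module _ (G : Multigraph) {Δ μ : ℕ}
           (degree≤Δ : ∀ v → degree G v ≤ Δ) (multiplicity≤μ : ∀ u v → multiplicity G u v ≤ μ) where
    open Multigraph G
    open PartialColouring G (Δ + μ)

    colouredAt? : ∀ φ v f → Dec (Incident G f v × Coloured φ f)
    colouredAt? φ v f = incident? G f v ×-dec coloured? φ f

    present≤coloured : ∀ φ v → count (∁? (missing? φ v)) ≤ count (colouredAt? φ v)
    present≤coloured φ v = count-injection _ _ (proj₁ ∘ present-edge)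
      (λ c-present → let _ , f-inc , φf = present-edge c-present in f-inc , _ , φf)
      (λ c-present c′-present same-edge →
        let _ , _ , φf = present-edge c-present ; _ , _ , φf′ = present-edge c′-present
        in just-injective (trans (sym φf) (trans (cong φ same-edge) φf′)))

    Δ+μ≤missing+coloured : ∀ φ v → Δ + μ ≤ count (missing? φ v) + count (colouredAt? φ v)
    Δ+μ≤missing+coloured φ v = begin
      Δ + μ                                                ≡⟨ sym (count+count∁≡n (missing? φ v)) ⟩
      count (missing? φ v) + count (∁? (missing? φ v))     ≤⟨ +-monoʳ-≤ _ (present≤coloured φ v) ⟩
      count (missing? φ v) + count (colouredAt? φ v)       ∎
      where open ≤-Reasoning

    coloured≤degree : ∀ φ v → count (colouredAt? φ v) ≤ Δ
    coloured≤degree φ v = ≤-trans (count-mono (colouredAt? φ v) (λ f → incident? G f v) proj₁)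
                            (≤-trans (≤-reflexive (sym (degree≡count G v))) (degree≤Δ v))

    μ≤missing : ∀ φ v → μ ≤ count (missing? φ v)
    μ≤missing φ v = +-cancelˡ-≤ Δ _ _ (begin
      Δ + μ                                                ≤⟨ Δ+μ≤missing+coloured φ v ⟩
      count (missing? φ v) + count (colouredAt? φ v)       ≤⟨ +-monoʳ-≤ _ (coloured≤degree φ v) ⟩
      count (missing? φ v) + Δ                             ≡⟨ +-comm _ Δ ⟩
      Δ + count (missing? φ v)                             ∎)
      where open ≤-Reasoning

    μ<missing : ∀ φ v → ∀ {e} → Incident G e v → φ e ≡ nothing → μ < count (missing? φ v)
    μ<missing φ v {e} e-inc φe = +-cancelˡ-≤ Δ _ _ (begin
      Δ + suc μ                                            ≡⟨ +-suc Δ μ ⟩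
      suc (Δ + μ)                                          ≤⟨ s≤s (Δ+μ≤missing+coloured φ v) ⟩
      suc (count (missing? φ v) + count (colouredAt? φ v)) ≡⟨ sym (+-suc _ _) ⟩
      count (missing? φ v) + suc (count (colouredAt? φ v)) ≤⟨ +-monoʳ-≤ _ coloured<degree ⟩
      count (missing? φ v) + Δ                             ≡⟨ +-comm _ Δ ⟩
      Δ + count (missing? φ v)                             ∎)
      where
      open ≤-Reasoning
      coloured<degree : count (colouredAt? φ v) < Δ
      coloured<degree = ≤-trans
        (count-strictMono (colouredAt? φ v) (λ f → incident? G f v) proj₁ e e-inc
          (uncoloured⇒¬coloured {φ} φe ∘ proj₂))
        (≤-trans (≤-reflexive (sym (degree≡count G v))) (degree≤Δ v))

    record Extension (φ : Colouring) (e : Fin m) : Set where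
      field
        colouring      : Colouring
        proper         : Proper colouring
        keeps-coloured : ∀ {f} → Coloured φ f → Coloured colouring f
        colours        : Coloured colouring e

    extension-via : ∀ {φ φ′ e} → (∀ {f} → Coloured φ f → Coloured φ′ f) → Extension φ′ e → Extension φ e
    extension-via φ⊆φ′ ext = record
      { colouring = colouring ; proper = proper ; keeps-coloured = keeps-coloured ∘ φ⊆φ′ ; colours = colours }
      where open Extension ext

    module FanAt (e₀ : Fin m) where

      x : Fin n
      x = end₁ e₀

      tip : Fin m → Fin n
      tip w = other G w x

      TipOf : List (Fin m) → Fin n → Set
      TipOf F v = Any (λ w → tip w ≡ v) F

      MissingAtTip : Colouring → List (Fin m) → Fin (Δ + μ) → Set
      MissingAtTip φ F c = Any (λ w → Missing φ (tip w) c) F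

      -- Lists are read backwards: the head is the edge added last, e₀ is the last element.
      data Fan (φ : Colouring) : List (Fin m) → Set where
        root   : Fan φ (e₀ ∷ [])
        extend : ∀ {F} g {c} → Fan φ F → Incident G g x → φ g ≡ just c →
                 ¬ TipOf F (tip g) → MissingAtTip φ F c → Fan φ (g ∷ F)

      fan-incident : ∀ {φ F w} → Fan φ F → w ∈ F → Incident G w x
      fan-incident root                       (here refl) = inj₁ refl
      fan-incident (extend _ _ g-inc _ _ _)   (here refl) = g-inc
      fan-incident (extend _ fan _ _ _ _)     (there w∈F) = fan-incident fan w∈F

      e₀∈fan : ∀ {φ F} → Fan φ F → e₀ ∈ F
      e₀∈fan root                   = here refl
      e₀∈fan (extend _ fan _ _ _ _) = there (e₀∈fan fan)

      fan-colour : ∀ {φ F h} → Fan φ F → h ∈ F →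
                   h ≡ e₀ ⊎ ∃[ c ] ∃[ w ] φ h ≡ just c × w ∈ F × Missing φ (tip w) c
      fan-colour root (here refl) = inj₁ refl
      fan-colour (extend _ {c} _ _ φg _ c-missing) (here refl) =
        let w , w∈F , missing = find c-missing in inj₂ (c , w , φg , there w∈F , missing)
      fan-colour (extend _ fan _ _ _ _) (there h∈F) with fan-colour fan h∈F
      ... | inj₁ h≡e₀ = inj₁ h≡e₀
      ... | inj₂ (c , w , φh , w∈F , missing) = inj₂ (c , w , φh , there w∈F , missing)

      fan-transport : ∀ {φ φ′ F} → Fan φ F →
                      (∀ {h c w} → h ∈ F → w ∈ F → φ h ≡ just c → Missing φ (tip w) c →
                         ∃[ c′ ] φ′ h ≡ just c′ × Missing φ′ (tip w) c′) →
                      Fan φ′ F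
      fan-transport root _ = root
      fan-transport (extend g fan g-inc φg new c-missing) preserve
        with w , w∈F , missing ← find c-missing
        with c′ , φ′g , missing′ ← preserve (here refl) (there w∈F) φg missing =
        extend g (fan-transport fan (λ h∈F w∈F → preserve (there h∈F) (there w∈F)))
          g-inc φ′g new (lose w∈F missing′)

      -- t gets α, and each earlier edge on the chain of witnesses from t back to e₀ gets the colour of the
      -- edge after it.
      fan-shift : ∀ {φ F t α} → Proper φ → φ e₀ ≡ nothing → Fan φ F → t ∈ F →
                  Missing φ x α → Missing φ (tip t) α → Extension φ e₀
      fan-shift {φ} {α = α} proper φe₀ root (here refl) α-at-x α-at-tip = record
        { colouring      = φ [ e₀ ≔ just α ]
        ; proper         = assign-proper proper α-free
        ; keeps-coloured = assign-coloured φ e₀ α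
        ; colours        = α , assign-eq φ e₀ (just α)
        }
        where
        α-free : ∀ {u} → Incident G e₀ u → Missing φ u α
        α-free u-inc with incident-ends G (inj₁ refl) u-inc
        ... | inj₁ refl = α-at-x
        ... | inj₂ refl = α-at-tip
      fan-shift {φ} {α = α} proper φe₀ (extend {F} g {c} fan g-inc φg new c-missing) (here refl)
                α-at-x α-at-tip =
        extension-via (assign-coloured φ g α)
          (fan-shift proper′ φ′e₀ fan′ w∈F c-at-x c-at-tip)
        where
        φ′ : Colouring
        φ′ = φ [ g ≔ just α ]
        w : Fin m
        w = proj₁ (find c-missing)
        w∈F : w ∈ F
        w∈F = proj₁ (proj₂ (find c-missing))
        g∉F : ∀ {h} → h ∈ F → h ≢ g
        g∉F h∈F refl = new (lose h∈F refl)
        g-off-tips : ∀ {w} → w ∈ F → ¬ Incident G g (tip w)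
        g-off-tips w∈F tip-inc with incident-ends G g-inc tip-inc
        ... | inj₁ tip≡x   = other≢ G (fan-incident fan w∈F) tip≡x
        ... | inj₂ tip≡tip = new (lose w∈F tip≡tip)
        α-free : ∀ {u} → Incident G g u → Missing φ u α
        α-free u-inc with incident-ends G g-inc u-inc
        ... | inj₁ refl = α-at-x
        ... | inj₂ refl = α-at-tip
        proper′ : Proper φ′
        proper′ = assign-proper proper α-free
        φ′e₀ : φ′ e₀ ≡ nothing
        φ′e₀ = trans (assign-neq φ _ (g∉F (e₀∈fan fan))) φe₀
        fan′ : Fan φ′ F
        fan′ = fan-transport fan λ h∈F w∈F φh missing →
          _ , trans (assign-neq φ _ (g∉F h∈F)) φh , assign-missing φ _ (g-off-tips w∈F) missing
        c-at-x : Missing φ′ x c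
        c-at-x {f} f-inc φ′f with f ≟ g
        ... | yes refl = α-at-x g-inc (trans φg (cong just (just-injective (trans (sym φ′f) (assign-eq φ g _)))))
        ... | no  f≢g  = f≢g (proper-unique proper f-inc g-inc (trans (sym (assign-neq φ _ f≢g)) φ′f) φg)
        c-at-tip : Missing φ′ (tip w) c
        c-at-tip = assign-missing φ _ (g-off-tips w∈F) (proj₂ (proj₂ (find c-missing)))
      fan-shift proper φe₀ (extend _ fan _ _ _ _) (there t∈F) α-at-x α-at-tip =
        fan-shift proper φe₀ fan t∈F α-at-x α-at-tip

      record Elementary (φ : Colouring) (F : List (Fin m)) : Set where
        field
          disjoint-centre : ∀ {w c} → w ∈ F → Missing φ x c → Missing φ (tip w) c → ⊥
          disjoint-tips   : ∀ {w w′ c} → w ∈ F → w′ ∈ F → tip w ≢ tip w′ →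
                            Missing φ (tip w) c → Missing φ (tip w′) c → ⊥

      elementary-tail : ∀ {φ g F} → Elementary φ (g ∷ F) → Elementary φ F
      elementary-tail el = record
        { disjoint-centre = disjoint-centre ∘ there
        ; disjoint-tips   = λ w∈F w′∈F → disjoint-tips (there w∈F) (there w′∈F)
        }
        where open Elementary el

      tipOf? : ∀ F v → Dec (TipOf F v)
      tipOf? F v = Any.any? (λ w → tip w ≟ v) F

      missingAtTip? : ∀ φ F c → Dec (MissingAtTip φ F c)
      missingAtTip? φ F c = Any.any? (λ w → missing? φ (tip w) c) F

      missingAtTips-lower : ∀ {φ F} → φ e₀ ≡ nothing → Fan φ F → Elementary φ F →
                            length F * μ < count (missingAtTip? φ F)
      missingAtTips-lower {φ} φe₀ root el = begin-strict
        μ + 0                                     ≡⟨ +-identityʳ μ ⟩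
        μ                                         <⟨ μ<missing φ (tip e₀) (incident-other G e₀ x) φe₀ ⟩
        count (missing? φ (tip e₀))
          ≤⟨ count-mono (missing? φ (tip e₀)) (missingAtTip? φ (e₀ ∷ [])) here ⟩
        count (missingAtTip? φ (e₀ ∷ []))         ∎
        where open ≤-Reasoning
      missingAtTips-lower {φ} φe₀ (extend {F} g fan _ _ new _) el = begin-strict
        μ + length F * μ
          <⟨ +-monoʳ-< μ (missingAtTips-lower φe₀ fan (elementary-tail el)) ⟩
        μ + count (missingAtTip? φ F)
          ≤⟨ +-monoˡ-≤ _ (μ≤missing φ (tip g)) ⟩
        count (missing? φ (tip g)) + count (missingAtTip? φ F)
          ≤⟨ count-∪-disjoint (missing? φ (tip g)) (missingAtTip? φ F) disjoint ⟩
        count (missing? φ (tip g) ∪? missingAtTip? φ F)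
          ≤⟨ count-mono (missing? φ (tip g) ∪? missingAtTip? φ F) (missingAtTip? φ (g ∷ F)) [ here , there ] ⟩
        count (missingAtTip? φ (g ∷ F))           ∎
        where
        open ≤-Reasoning
        disjoint : ∀ {c} → Missing φ (tip g) c → MissingAtTip φ F c → ⊥
        disjoint c-at-g c-at-F with w , w∈F , c-at-w ← find c-at-F =
          Elementary.disjoint-tips el (here refl) (there w∈F) (λ eq → new (lose w∈F (sym eq))) c-at-g c-at-w

      edgeToTip? : ∀ F g → Dec (Incident G g x × TipOf F (tip g))
      edgeToTip? F g = incident? G g x ×-dec tipOf? F (tip g)

      edgesToTips≤ : ∀ F → count (edgeToTip? F) ≤ length F * μ
      edgesToTips≤ [] = ≤-reflexive (count-none (edgeToTip? []) λ { _ (_ , ()) })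
      edgesToTips≤ (w ∷ F) = begin
        count (edgeToTip? (w ∷ F))                ≤⟨ count-mono _ (toW? ∪? edgeToTip? F) split ⟩
        count (toW? ∪? edgeToTip? F)              ≤⟨ count-∪ toW? (edgeToTip? F) ⟩
        count toW? + count (edgeToTip? F)         ≤⟨ +-mono-≤ toW≤μ (edgesToTips≤ F) ⟩
        μ + length F * μ                          ∎
        where
        open ≤-Reasoning
        toW? : ∀ g → Dec (Incident G g x × tip g ≡ tip w)
        toW? g = incident? G g x ×-dec (tip g ≟ tip w)
        split : ∀ {g} → Incident G g x × TipOf (w ∷ F) (tip g) →
                (Incident G g x × tip g ≡ tip w) ⊎ (Incident G g x × TipOf F (tip g))
        split (g-inc , here tip-w≡tip-g) = inj₁ (g-inc , sym tip-w≡tip-g)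
        split (g-inc , there at-F)       = inj₂ (g-inc , at-F)
        toW≤μ : count toW? ≤ μ
        toW≤μ = begin
          count toW?                              ≤⟨ count-mono toW? (λ g → joins? G g x (tip w)) joins ⟩
          count (λ g → joins? G g x (tip w))      ≡⟨ sym (multiplicity≡count G x (tip w)) ⟩
          multiplicity G x (tip w)                ≤⟨ multiplicity≤μ x (tip w) ⟩
          μ                                       ∎
          where
          joins : ∀ {g} → Incident G g x × tip g ≡ tip w → Joins G g x (tip w)
          joins (g-inc , tip-g≡tip-w) = subst (Joins G _ x) tip-g≡tip-w (joins-other G g-inc)

      Extends : Colouring → List (Fin m) → Fin m → Set
      Extends φ F g = Incident G g x × ¬ TipOf F (tip g) × ∃[ c ] φ g ≡ just c × MissingAtTip φ F c

      extends? : ∀ φ F g → Dec (Extends φ F g)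
      extends? φ F g = incident? G g x ×-dec ¬? (tipOf? F (tip g)) ×-dec
                       any? (λ c → Maybe.≡-dec _≟_ (φ g) (just c) ×-dec missingAtTip? φ F c)

      -- Each colour missing at a tip is present at x on an edge that, the fan being maximal,
      -- goes to a tip; e₀ goes to a tip as well but is uncoloured, and at most μ edges join x to each tip.
      maximal-fan-impossible : ∀ {φ F} → φ e₀ ≡ nothing → Fan φ F → Elementary φ F →
                               (∀ g → ¬ Extends φ F g) → ⊥
      maximal-fan-impossible {φ} {F} φe₀ fan el maximal = 1+n≰n (begin-strict
        length F * μ                              <⟨ missingAtTips-lower φe₀ fan el ⟩
        count (missingAtTip? φ F)                 ≤⟨ count-injection (missingAtTip? φ F) colouredToTip?
                                                       (proj₁ ∘ witness) witness-to-tip witness-injective ⟩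
        count colouredToTip?                      <⟨ count-strictMono colouredToTip? (edgeToTip? F) proj₁ e₀
                                                       (inj₁ refl , lose (e₀∈fan fan) refl)
                                                       (uncoloured⇒¬coloured {φ} φe₀ ∘ proj₂) ⟩
        count (edgeToTip? F)                      ≤⟨ edgesToTips≤ F ⟩
        length F * μ                              ∎)
        where
        open ≤-Reasoning
        colouredToTip? : ∀ g → Dec ((Incident G g x × TipOf F (tip g)) × Coloured φ g)
        colouredToTip? g = edgeToTip? F g ×-dec coloured? φ g
        witness : ∀ {c} → MissingAtTip φ F c → ∃[ g ] Incident G g x × φ g ≡ just c
        witness c-at-F = present-edge λ c-at-x →
          let w , w∈F , c-at-w = find c-at-F in Elementary.disjoint-centre el w∈F c-at-x c-at-w
        witness-to-tip : ∀ {c} (c-at-F : MissingAtTip φ F c) →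
                         (Incident G (proj₁ (witness c-at-F)) x × TipOf F (tip (proj₁ (witness c-at-F)))) ×
                         Coloured φ (proj₁ (witness c-at-F))
        witness-to-tip {c} c-at-F with g , g-inc , φg ← witness c-at-F with tipOf? F (tip g)
        ... | yes at-tip = (g-inc , at-tip) , c , φg
        ... | no ¬at-tip = ⊥-elim (maximal g (g-inc , ¬at-tip , c , φg , c-at-F))
        witness-injective : ∀ {c c′} (p : MissingAtTip φ F c) (p′ : MissingAtTip φ F c′) →
                            proj₁ (witness p) ≡ proj₁ (witness p′) → c ≡ c′
        witness-injective p p′ same = just-injective
          (trans (sym (proj₂ (proj₂ (witness p)))) (trans (cong φ same) (proj₂ (proj₂ (witness p′)))))

      -- The part of F up to an edge whose tip misses a colour δ that is also missing at y. No edge of it is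
      -- coloured δ, so it survives an α/δ swap that avoids x.
      record Prefix (φ : Colouring) (F : List (Fin m)) (y : Fin n) : Set where
        field
          sub        : List (Fin m)
          sub-fan    : Fan φ sub
          sub⊆F      : ∀ {h} → h ∈ sub → h ∈ F
          pivot      : Fin m
          pivot∈sub  : pivot ∈ sub
          δ          : Fin (Δ + μ)
          δ-at-y     : Missing φ y δ
          δ-at-pivot : Missing φ (tip pivot) δ
          δ-unused   : ∀ {h} → h ∈ sub → φ h ≢ just δ

      prefix-sharing : ∀ {φ F} → φ e₀ ≡ nothing → Fan φ F → Elementary φ F → ∀ y →
                       Prefix φ F y ⊎ (∀ {w d} → w ∈ F → Missing φ y d → Missing φ (tip w) d → ⊥)
      prefix-sharing {φ} φe₀ root el y with any? (λ d → missing? φ y d ×-dec missing? φ (tip e₀) d)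
      ... | yes (d , d-at-y , d-at-e₀) = inj₁ record
        { sub = e₀ ∷ [] ; sub-fan = root ; sub⊆F = λ h∈ → h∈ ; pivot = e₀ ; pivot∈sub = here refl
        ; δ = d ; δ-at-y = d-at-y ; δ-at-pivot = d-at-e₀
        ; δ-unused = λ { (here refl) φe₀′ → uncoloured⇒¬coloured {φ} φe₀ (d , φe₀′) }
        }
      ... | no ¬shared = inj₂ λ { (here refl) d-at-y d-at-e₀ → ¬shared (_ , d-at-y , d-at-e₀) }
      prefix-sharing {φ} φe₀ (extend {F} g fan g-inc φg new c-at-F) el y
        with any? (λ d → missing? φ y d ×-dec missing? φ (tip g) d)
      ... | yes (d , d-at-y , d-at-g) = inj₁ record
        { sub = g ∷ F ; sub-fan = extend g fan g-inc φg new c-at-F ; sub⊆F = λ h∈ → h∈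
        ; pivot = g ; pivot∈sub = here refl ; δ = d ; δ-at-y = d-at-y ; δ-at-pivot = d-at-g
        ; δ-unused = unused
        }
        where
        unused : ∀ {h} → h ∈ g ∷ F → φ h ≢ just d
        unused (here refl) φg′ = d-at-g (incident-other G g x) φg′
        unused (there h∈F) φh with fan-colour fan h∈F
        ... | inj₁ refl = uncoloured⇒¬coloured {φ} φe₀ (d , φh)
        ... | inj₂ (c′ , w , φh′ , w∈F , c′-at-w) =
          Elementary.disjoint-tips el (there w∈F) (here refl) (λ eq → new (lose w∈F eq))
            (subst (Missing φ (tip w)) (just-injective (trans (sym φh′) φh)) c′-at-w) d-at-g
      ... | no ¬shared with prefix-sharing φe₀ fan (elementary-tail el) y
      ...   | inj₁ prefix = inj₁ record
        { sub = sub ; sub-fan = sub-fan ; sub⊆F = there ∘ sub⊆F ; pivot = pivot ; pivot∈sub = pivot∈sub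
        ; δ = δ ; δ-at-y = δ-at-y ; δ-at-pivot = δ-at-pivot ; δ-unused = δ-unused }
        where open Prefix prefix
      ...   | inj₂ disjoint = inj₂ λ { (here refl) d-at-y d-at-g → ¬shared (_ , d-at-y , d-at-g)
                                     ; (there w∈F) → disjoint w∈F }

      -- The new edge g is coloured with a colour missing at a tip, but its tip shares a missing colour δ with
      -- the tip of an earlier edge. Swapping α and δ (α missing at x) along the α/δ-path from that earlier tip
      -- leaves a fan that can be shifted: the path cannot reach both x and the tip of g.
      module KempeCase {φ F g c} (proper : Proper φ) (φe₀ : φ e₀ ≡ nothing)
                       (fan : Fan φ F) (el : Elementary φ F) (g-inc : Incident G g x) (φg : φ g ≡ just c) (new : ¬ TipOf F (tip g))
                       (c-at-F : MissingAtTip φ F c) (prefix : Prefix φ F (tip g)) where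
        open Prefix prefix
        open Elementary el

        α-missing : ∃[ α ] Missing φ x α
        α-missing = 0<count⇒∃ (missing? φ x) (≤-trans (s≤s z≤n) (μ<missing φ x (inj₁ refl) φe₀))

        α : Fin (Δ + μ)
        α = proj₁ α-missing

        α-at-x : Missing φ x α
        α-at-x = proj₂ α-missing

        pivot∈F : pivot ∈ F
        pivot∈F = sub⊆F pivot∈sub

        α≢δ : α ≢ δ
        α≢δ refl = disjoint-centre pivot∈F α-at-x δ-at-pivot

        α-present : ¬ Missing φ (tip pivot) α
        α-present = disjoint-centre pivot∈F α-at-x

        colour-at-x≢α : ∀ {h c′} → Incident G h x → φ h ≡ just c′ → c′ ≢ α
        colour-at-x≢α h-inc φh refl = α-at-x h-inc φh

        open Kempe G (Δ + μ) proper α≢δ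
        open Chain (tip pivot) δ-at-pivot α-present
        open KempeChain kempeChain

        φ′ : Colouring
        φ′ = swapOn edges

        extend-by-shift : ∀ {F′ t β} → Fan φ′ F′ → t ∈ F′ → Missing φ′ x β → Missing φ′ (tip t) β →
                          Extension φ e₀
        extend-by-shift fan′ t∈F′ β-at-x β-at-t = extension-via (swapOn-coloured closed)
          (fan-shift (swapOn-proper closed) (swapOn-uncoloured closed φe₀) fan′ t∈F′ β-at-x β-at-t)

        α-at-pivot′ : Missing φ′ (tip pivot) α
        α-at-pivot′ = swapOn-missing closed touches-start (subst (Missing φ (tip pivot)) (sym swap-α) δ-at-pivot)

        centre-untouched : ¬ Touches edges x → Extension φ e₀
        centre-untouched x-untouched =
          extend-by-shift sub-fan′ pivot∈sub (swapOn-missing-untouched closed x-untouched α-at-x) α-at-pivot′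
          where
          sub-fan′ : Fan φ′ sub
          sub-fan′ = fan-transport sub-fan λ {h} h∈sub _ φh c′-at-w →
            let h-inc = fan-incident sub-fan h∈sub in
            _ , trans (swapOn-∉ closed (untouched-∉ closed x-untouched h-inc)) φh
              , swapOn-missing-other closed (colour-at-x≢α h-inc φh) (λ { refl → δ-unused h∈sub φh }) c′-at-w

        tip-g-untouched : Touches edges x → ¬ Touches edges (tip g)
        tip-g-untouched x-touched tip-g-touched = ends-clash (touched x-touched) (touched tip-g-touched)
          where
          ends-clash : x ≡ tip pivot ⊎ x ≡ end ⊎ Saturated x →
                       tip g ≡ tip pivot ⊎ tip g ≡ end ⊎ Saturated (tip g) → ⊥
          ends-clash (inj₁ x≡tip) _ = other≢ G (fan-incident fan pivot∈F) (sym x≡tip)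
          ends-clash (inj₂ (inj₂ (α-present-at-x , _))) _ = α-present-at-x α-at-x
          ends-clash (inj₂ (inj₁ _)) (inj₁ tip-g≡tip) = new (lose pivot∈F (sym tip-g≡tip))
          ends-clash (inj₂ (inj₁ _)) (inj₂ (inj₂ (_ , δ-present))) = δ-present δ-at-y
          ends-clash (inj₂ (inj₁ x≡end)) (inj₂ (inj₁ tip-g≡end)) = other≢ G g-inc (trans tip-g≡end (sym x≡end))

        centre-touched : Touches edges x → Extension φ e₀
        centre-touched x-touched@(t , t-inc , t∈edges) =
          extend-by-shift fan′ (here refl)
            (swapOn-missing closed x-touched (subst (Missing φ x) (sym swap-δ) α-at-x))
            (swapOn-missing-untouched closed (tip-g-untouched x-touched) δ-at-y)
          where
          preserve : ∀ {h c′ w} → h ∈ F → w ∈ F → φ h ≡ just c′ → Missing φ (tip w) c′ →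
                     ∃[ c″ ] φ′ h ≡ just c″ × Missing φ′ (tip w) c″
          preserve {h} {c′} {w} h∈F w∈F φh c′-at-w = by-membership (h ∈? edges)
            where
            h-inc : Incident G h x
            h-inc = fan-incident fan h∈F

            α-at-w : c′ ≡ δ → Dec (tip w ≡ tip pivot) → Missing φ′ (tip w) α
            α-at-w _    (yes tip-w≡tip) = subst (λ u → Missing φ′ u α) (sym tip-w≡tip) α-at-pivot′
            α-at-w refl (no  tip-w≢tip) = ⊥-elim (disjoint-tips w∈F pivot∈F tip-w≢tip c′-at-w δ-at-pivot)

            swapped : h Subset.∈ edges → Bicoloured h → ∃[ c″ ] φ′ h ≡ just c″ × Missing φ′ (tip w) c″
            swapped h∈edges (inj₁ φh≡α) = ⊥-elim (α-at-x h-inc φh≡α)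
            swapped h∈edges (inj₂ φh≡δ) =
              α , trans (swapOn-∈ closed h∈edges φh≡δ) (cong just swap-δ) ,
              α-at-w (just-injective (trans (sym φh) φh≡δ)) (tip w ≟ tip pivot)

            by-membership : Dec (h Subset.∈ edges) → ∃[ c″ ] φ′ h ≡ just c″ × Missing φ′ (tip w) c″
            by-membership (yes h∈edges) = swapped h∈edges (Closed.bicoloured-⊆ closed h∈edges)
            by-membership (no h∉edges) =
              c′ , trans (swapOn-∉ closed h∉edges) φh ,
              swapOn-missing-other closed (colour-at-x≢α h-inc φh) c′≢δ c′-at-w
              where
              c′≢δ : c′ ≢ δ
              c′≢δ refl = h∉edges (Closed.balanced closed t-inc h-inc (inj₂ φh) t∈edges)

          fan′ : Fan φ′ (g ∷ F)
          fan′ = extend g (fan-transport fan preserve) g-inc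
            (trans (swapOn-∉ closed (untouched-∉ closed (tip-g-untouched x-touched) (incident-other G g x))) φg)
            new
            (lose (proj₁ (proj₂ (find c-at-F)))
              (swapOn-missing-other closed (colour-at-x≢α g-inc φg)
                (λ { refl → δ-at-y (incident-other G g x) φg }) (proj₂ (proj₂ (find c-at-F)))))

        extension : Extension φ e₀
        extension = [ centre-touched , centre-untouched ]′ (toSum (touches? edges x))

      elementary-extend : ∀ {φ g F} → Elementary φ F →
                          (∀ {d} → Missing φ x d → Missing φ (tip g) d → ⊥) →
                          (∀ {w d} → w ∈ F → Missing φ (tip g) d → Missing φ (tip w) d → ⊥) →
                          Elementary φ (g ∷ F)
      elementary-extend {φ} {g} {F} el disjoint-x disjoint-F = record
        { disjoint-centre = disjoint-centre′ ; disjoint-tips = disjoint-tips′ }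
        where
        open Elementary el
        disjoint-centre′ : ∀ {w d} → w ∈ g ∷ F → Missing φ x d → Missing φ (tip w) d → ⊥
        disjoint-centre′ (here refl) = disjoint-x
        disjoint-centre′ (there w∈F) = disjoint-centre w∈F
        disjoint-tips′ : ∀ {w w′ d} → w ∈ g ∷ F → w′ ∈ g ∷ F → tip w ≢ tip w′ →
                         Missing φ (tip w) d → Missing φ (tip w′) d → ⊥
        disjoint-tips′ (here refl)  (here refl)  tips≢   = ⊥-elim (tips≢ refl)
        disjoint-tips′ (here refl)  (there w′∈F) _ d-at-g d-at-w′ = disjoint-F w′∈F d-at-g d-at-w′
        disjoint-tips′ (there w∈F)  (here refl)  _ d-at-w d-at-g = disjoint-F w∈F d-at-g d-at-w
        disjoint-tips′ (there w∈F)  (there w′∈F)           = disjoint-tips w∈F w′∈F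

      nonTips : List (Fin m) → ℕ
      nonTips F = count (∁? (tipOf? F))

      nonTips-shrinks : ∀ {g F} → ¬ TipOf F (tip g) → nonTips (g ∷ F) < nonTips F
      nonTips-shrinks {g} {F} new =
        count-strictMono (∁? (tipOf? (g ∷ F))) (∁? (tipOf? F)) (_∘ there) (tip g) new (λ ¬tip → ¬tip (here refl))

      -- Each round either finishes by a shift or a Kempe swap, or adds an edge with a new tip.
      grow : ∀ bound {φ F} → Proper φ → φ e₀ ≡ nothing → Fan φ F → Elementary φ F →
             nonTips F ≤ bound → Extension φ e₀
      grow bound {φ} {F} proper φe₀ fan el ≤bound with any? (extends? φ F)
      ... | no maximal = ⊥-elim (maximal-fan-impossible φe₀ fan el λ g ext → maximal (g , ext))
      ... | yes (g , g-inc , new , c , φg , c-at-F)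
        with fan′ ← extend g fan g-inc φg new c-at-F
        with any? (λ α → missing? φ x α ×-dec missing? φ (tip g) α)
      ...   | yes (α , α-at-x , α-at-g) = fan-shift proper φe₀ fan′ (here refl) α-at-x α-at-g
      ...   | no ¬shared with prefix-sharing φe₀ fan el (tip g)
      ...     | inj₁ prefix = KempeCase.extension proper φe₀ fan el g-inc φg new c-at-F prefix
      ...     | inj₂ disjoint with bound
      ...       | zero = ⊥-elim (n≮0 (<-≤-trans (nonTips-shrinks new) ≤bound))
      ...       | suc bound′ = grow bound′ proper φe₀ fan′
                                 (elementary-extend el (λ d-at-x d-at-g → ¬shared (_ , d-at-x , d-at-g)) disjoint)
                                 (≤-pred (<-≤-trans (nonTips-shrinks new) ≤bound))

      colour-edge : ∀ {φ} → Proper φ → φ e₀ ≡ nothing → Extension φ e₀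
      colour-edge {φ} proper φe₀ with any? (λ α → missing? φ x α ×-dec missing? φ (tip e₀) α)
      ... | yes (α , α-at-x , α-at-e₀) = fan-shift proper φe₀ root (here refl) α-at-x α-at-e₀
      ... | no ¬shared = grow n proper φe₀ root el₀ (count≤n _)
        where
        el₀ : Elementary φ (e₀ ∷ [])
        el₀ = record
          { disjoint-centre = λ { (here refl) d-at-x d-at-e₀ → ¬shared (_ , d-at-x , d-at-e₀) }
          ; disjoint-tips   = λ { (here refl) (here refl) tips≢ → ⊥-elim (tips≢ refl) }
          }

    colour-all : ∀ (L : List (Fin m)) → ∃[ φ ] Proper φ × (∀ {f} → f ∈ L → Coloured φ f)
    colour-all [] = (λ _ → nothing) , (λ _ _ _ ()) , λ ()
    colour-all (e ∷ L) with φ , proper , L-coloured ← colour-all L with coloured? φ e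
    ... | yes e-coloured = φ , proper , λ { (here refl) → e-coloured ; (there f∈L) → L-coloured f∈L }
    ... | no ¬e-coloured =
      colouring , proper′ , λ { (here refl) → colours ; (there f∈L) → keeps-coloured (L-coloured f∈L) }
      where
      open Extension (FanAt.colour-edge e proper (¬coloured⇒uncoloured {φ} ¬e-coloured))
        renaming (proper to proper′)

  vizing : (G : Multigraph) {Δ μ : ℕ} → (∀ v → degree G v ≤ Δ) → (∀ u v → multiplicity G u v ≤ μ) →
           ∃[ c ] ProperEdgeColouring G {Fin (Δ + μ)} c
  vizing G degree≤Δ multiplicity≤μ
    with φ , proper , coloured ← colour-all G degree≤Δ multiplicity≤μ (allFin _) =
    PartialColouring.total⇒proper G _ proper (coloured ∘ ∈-allFin)

open VizingFans using (vizing)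
open import Data.Fin.Subset using (_∈_)
import Data.List.Membership.Propositional as List

≤-foldr-⊔ : ∀ {x} xs → x List.∈ xs → x ≤ foldr _⊔_ 0 xs
≤-foldr-⊔ (x ∷ xs) (here refl) = m≤m⊔n x _
≤-foldr-⊔ (x ∷ xs) (there x∈xs) = ≤-trans (≤-foldr-⊔ xs x∈xs) (m≤n⊔m x _)

↑ˡ≢↑ʳ : ∀ {m n} (i : Fin m) (j : Fin n) → i ↑ˡ n ≢ m ↑ʳ j
↑ˡ≢↑ʳ {m} {n} i j eq
  with () ← trans (sym (splitAt-↑ˡ m i n)) (trans (cong (splitAt m) eq) (splitAt-↑ʳ m n j))

module _ (G : Multigraph) where
  open Multigraph G

  degree≤maxDegree : ∀ v → degree G v ≤ maxDegree G
  degree≤maxDegree v = ≤-foldr-⊔ _ (∈-map⁺ (degree G) (∈-allFin v))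

  multiplicity≤maxMultiplicity : ∀ u v → multiplicity G u v ≤ maxMultiplicity G
  multiplicity≤maxMultiplicity u v = ≤-trans (≤-foldr-⊔ _ (∈-map⁺ (multiplicity G u) (∈-allFin v)))
    (≤-foldr-⊔ _ (∈-map⁺ (λ u → maxℕ G (map (multiplicity G u) (allFin n))) (∈-allFin u)))

  equal-or-adjacent : ∀ {e a b} → Incident G e a → Incident G e b → a ≡ b ⊎ Adjacent G a b
  equal-or-adjacent {e} {a} a-inc b-inc with incident-ends G a-inc b-inc
  ... | inj₁ b≡a       = inj₁ (sym b≡a)
  ... | inj₂ refl = inj₂ (e , joins-other G a-inc)

  within3 : ∀ {a v b} → a ≡ v ⊎ Adjacent G a v → v ≡ b ⊎ Adjacent G v b → Within3 G a b
  within3 (inj₁ refl) (inj₁ refl) = inj₁ refl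
  within3 (inj₁ refl) (inj₂ adj)  = inj₂ (inj₁ adj)
  within3 (inj₂ adj)  (inj₁ refl) = inj₂ (inj₁ adj)
  within3 {v = v} (inj₂ adj₁) (inj₂ adj₂) = inj₂ (inj₂ (v , adj₁ , adj₂))

  walk⇒edgeDist≤3 : ∀ {g e f h a v b} → Incident G g a → Incident G e a → Incident G e v →
                    Incident G f v → Incident G f b → Incident G h b → EdgeDistAtMost3 G g h
  walk⇒edgeDist≤3 {a = a} {b = b} g-a e-a e-v f-v f-b h-b =
    a , b , g-a , h-b , within3 (equal-or-adjacent e-a e-v) (equal-or-adjacent f-v f-b)

module PrecolouringExtension (G : Multigraph) (M : Subset (Multigraph.m G)) (matching : Distance3Matching G M)
                             (pre : Fin (Multigraph.m G) → Palette G) where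
  open Multigraph G

  vizing-colouring : ∃[ c ] ProperEdgeColouring G c
  vizing-colouring = vizing G (degree≤maxDegree G) (multiplicity≤maxMultiplicity G)

  κ : Fin m → Palette G
  κ f = proj₁ vizing-colouring f ↑ˡ 1

  ω : Palette G
  ω = (maxDegree G + maxMultiplicity G) ↑ʳ zero

  κ≢ω : ∀ {f} → κ f ≢ ω
  κ≢ω = ↑ˡ≢↑ʳ _ zero

  κ-proper : ∀ {e f v} → e ≢ f → Incident G e v → Incident G f v → κ e ≢ κ f
  κ-proper {e} {f} {v} e≢f e-inc f-inc κe≡κf =
    proj₂ vizing-colouring e f v e≢f e-inc f-inc (↑ˡ-injective 1 _ _ κe≡κf)

  Conflict : Fin m → Set
  Conflict e = ∃[ g ] g ∈ M × (∃[ v ] Incident G e v × Incident G g v) × κ e ≡ pre g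

  conflict? : ∀ e → Dec (Conflict e)
  conflict? e = any? λ g →
    (g ∈? M) ×-dec any? (λ v → incident? G e v ×-dec incident? G g v) ×-dec (κ e ≟ pre g)

  colourBy : ∀ e → Dec (e ∈ M) → Dec (Conflict e) → Palette G
  colourBy e (yes _) _       = pre e
  colourBy e (no  _) (yes _) = ω
  colourBy e (no  _) (no  _) = κ e

  colour : Fin m → Palette G
  colour e = colourBy e (e ∈? M) (conflict? e)

  far-apart : ∀ {g e f h a v b} → g ∈ M → h ∈ M → g ≢ h → Incident G g a → Incident G e a → Incident G e v →
              Incident G f v → Incident G f b → Incident G h b → ⊥
  far-apart g∈M h∈M g≢h g-a e-a e-v f-v f-b h-b =
    matching _ _ g∈M h∈M g≢h (walk⇒edgeDist≤3 G g-a e-a e-v f-v f-b h-b)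

  precoloured-vs-other : ∀ {e f v} → e ∈ M → Incident G e v → Incident G f v →
                         (f∉M : ¬ f ∈ M) (d : Dec (Conflict f)) → pre e ≢ colourBy f (no f∉M) d
  precoloured-vs-other {e} e∈M e-v f-v _ (yes (g , g∈M , (w , f-w , g-w) , κf≡pre-g)) pre-e≡ω
    with g ≟ e
  ... | yes refl = κ≢ω (trans κf≡pre-g pre-e≡ω)
  ... | no  g≢e  = far-apart e∈M g∈M (g≢e ∘ sym) e-v e-v e-v f-v f-w g-w
  precoloured-vs-other {e} {v = v} e∈M e-v f-v _ (no ¬conflict) pre-e≡κf =
    ¬conflict (e , e∈M , (v , f-v , e-v) , sym pre-e≡κf)

  colourBy-proper : ∀ {e f v} → e ≢ f → Incident G e v → Incident G f v →
                    ∀ d₁ d₂ d₃ d₄ → colourBy e d₁ d₂ ≢ colourBy f d₃ d₄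
  colourBy-proper {v = v} e≢f e-v f-v (yes e∈M) _ (yes f∈M) _ _ =
    matching _ _ e∈M f∈M e≢f (v , v , e-v , f-v , inj₁ refl)
  colourBy-proper e≢f e-v f-v (yes e∈M) _ (no f∉M) d eq = precoloured-vs-other e∈M e-v f-v f∉M d eq
  colourBy-proper e≢f e-v f-v (no e∉M) d (yes f∈M) _ eq =
    precoloured-vs-other f∈M f-v e-v e∉M d (sym eq)
  colourBy-proper e≢f e-v f-v (no _) (yes (g , g∈M , (a , e-a , g-a) , κe≡pre-g))
                              (no _) (yes (h , h∈M , (b , f-b , h-b) , κf≡pre-h)) _ with g ≟ h
  ... | yes refl = κ-proper e≢f e-v f-v (trans κe≡pre-g (sym κf≡pre-h))
  ... | no  g≢h  = far-apart g∈M h∈M g≢h g-a e-a e-v f-v f-b h-b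
  colourBy-proper e≢f e-v f-v (no _) (yes _) (no _) (no _) eq = κ≢ω (sym eq)
  colourBy-proper e≢f e-v f-v (no _) (no _) (no _) (yes _) eq = κ≢ω eq
  colourBy-proper e≢f e-v f-v (no _) (no _) (no _) (no _) eq = κ-proper e≢f e-v f-v eq

  colour-proper : ProperEdgeColouring G colour
  colour-proper e f v e≢f e-v f-v = colourBy-proper e≢f e-v f-v (e ∈? M) (conflict? e) (f ∈? M) (conflict? f)

  colour-extends : ∀ e → e ∈ M → colour e ≡ pre e
  colour-extends e e∈M with e ∈? M
  ... | yes _   = refl
  ... | no  e∉M = ⊥-elim (e∉M e∈M)

proposition1p2 : (G : Multigraph) (M : Subset (Multigraph.m G)) →
    Distance3Matching G M →
    (pre : Fin (Multigraph.m G) → Palette G) →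
    Σ[ c ∈ (Fin (Multigraph.m G) → Palette G) ]
      (ProperEdgeColouring G c × (∀ e → e ∈ M → c e ≡ pre e))
proposition1p2 G M matching pre = colour , colour-proper , colour-extends
  where open PrecolouringExtension G M matching pre
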